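{- Let $m\geq 2$ and $n\geq d\geq 1$ be integers. Let $d'$ be an integer with $1\leq d'\leq d$, and let $n'=\left\lceil \frac{n}{\lfloor d/d'\rfloor}\right\rceil$. Suppose the Hamming graph $H(n',m)$ admits a partition $\Pi'$ into $m$ sets with $\Delta(\Pi')\leq d'$ and $\iota(\Pi')\geq i'$. Then $H(n,m)$ admits a partition $\Pi$ into $m$ sets with $\Delta(\Pi)\leq d$ and $\iota(\Pi)\geq m^{n-n'} i'$.
   Context: The Hamming graph $H(k,m)$ has vertex set $\{0,\dots,m-1\}^k$, two vertices being adjacent iff they differ in exactly one coordinate. A partition $\Pi=\{V_1,\dots,V_m\}$ of its vertex set into $m$ sets means $m$ pairwise disjoint (possibly empty) sets whose union is the vertex set. $\Delta(\Pi)$ is the maximum over $i$ of the maximum degree of the subgraph of $H(k,m)$ induced by $V_i$, and the imbalance is $\iota(\Pi)=\sum_{i=1}^m \bigl||V_i|-m^{k-1}\bigr|$. -}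

module Defs where

open import Data.Nat using (ℕ; zero; suc; _+_; _*_; _∸_; _^_; _≤_; ∣_-_∣; _/_)
open import Data.Fin using (Fin; _≟_)
open import Data.Vec using (Vec; []; _∷_; lookup; _[_]≔_)
open import Data.List using (List; []; _∷_; map; concat; concatMap; filter; length)
open import Data.Nat.ListAction using (sum)
open import Data.List using (allFin)
open import Relation.Nullary using (¬?)

vertices : (k m : ℕ) → List (Vec (Fin m) k)
vertices zero    m = [] ∷ []
vertices (suc k) m = concatMap (λ a → map (a ∷_) (vertices k m)) (allFin m)

neighbours : {k m : ℕ} → Vec (Fin m) k → List (Vec (Fin m) k)
neighbours {k} {m} v =
  concatMap (λ j → map (λ a → v [ j ]≔ a)
                       (filter (λ a → ¬? (a ≟ lookup v j)) (allFin m)))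
            (allFin k)

-- A partition Π = {V_1,…,V_m} of V(H(k,m)) into m (possibly empty) sets is
-- given by its class-assignment c : vertex → Fin m  (V_i = c⁻¹(i)).
Partition : (k m : ℕ) → Set
Partition k m = Vec (Fin m) k → Fin m

inducedDegree : {k m : ℕ} → Partition k m → Vec (Fin m) k → ℕ
inducedDegree c v = length (filter (λ w → c w ≟ c v) (neighbours v))

MaxDegreeAtMost : {k m : ℕ} → Partition k m → ℕ → Set
MaxDegreeAtMost {k} {m} c d = (v : Vec (Fin m) k) → inducedDegree c v ≤ d

classSize : {k m : ℕ} → Partition k m → Fin m → ℕ
classSize {k} {m} c i = length (filter (λ v → c v ≟ i) (vertices k m))

imbalance : {k m : ℕ} → Partition k m → ℕ
imbalance {k} {m} c = sum (map (λ i → ∣ classSize c i - m ^ (k ∸ 1) ∣) (allFin m))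

-- ⌊a/b⌋ and ⌈a/b⌉; the value at b = 0 is junk (never used under the hypotheses)
floorDiv : ℕ → ℕ → ℕ
floorDiv a zero    = zero
floorDiv a (suc b) = a / suc b

ceilDiv : ℕ → ℕ → ℕ
ceilDiv a zero    = zero
ceilDiv a (suc b) = (a + b) / suc b

nPrime : (n d d' : ℕ) → ℕ
nPrime n d d' = ceilDiv n (floorDiv d d')

-- Group the n coordinates of H(n,m) into n' consecutive blocks of at most
-- q = ⌊d/d'⌋ coordinates each, and map a vertex to the word of its block sums
-- modulo m. Since addition in ℤ/m is a bijection in each argument, every
-- neighbour of v along a coordinate of block j maps to a neighbour of the
-- image along coordinate j, and each of those arises from exactly |block j|
-- neighbours of v. Pulling back Π' along this map therefore multiplies
-- induced degrees by at most q, so Δ ≤ q d' ≤ d; and as all fibres have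
-- m^(n-n') elements, every class size, the average m^(n-1), and hence the
-- imbalance, is multiplied by m^(n-n').
module Submission where

open import Defs

module ListSums where

  open import Data.Fin using (Fin; zero; suc)
  open import Data.Fin.Permutation using (Permutation; _⟨$⟩ʳ_)
  open import Data.List using (List; []; _∷_; map; concatMap; filter; length; _++_; tabulate; allFin)
  open import Data.List.Properties using (map-++)
  open import Data.Nat using (ℕ; zero; suc; _+_; _*_)
  open import Data.Nat.ListAction using (sum)
  open import Data.Nat.ListAction.Properties using (sum-++)
  open import Data.Nat.Properties using (+-0-commutativeMonoid; +-identityʳ; *-zeroʳ; *-distribˡ-+)
  open import Algebra.Properties.CommutativeMonoid.Sum +-0-commutativeMonoid
    using (sum-permute) renaming (sum to sumᶠ)
  open import Function using (_∘_; id)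
  open import Relation.Nullary using (Dec; yes; no)
  open import Relation.Nullary.Negation using (contradiction)
  open import Relation.Binary.PropositionalEquality
  open ≡-Reasoning

  private
    variable
      A B : Set
      n : ℕ

  ∑ : List A → (A → ℕ) → ℕ
  ∑ xs f = sum (map f xs)

  syntax ∑ xs (λ x → e) = ∑[ x ∈ xs ] e

  indicator : {P : Set} → Dec P → ℕ
  indicator (yes _) = 1
  indicator (no _)  = 0

  indicator-cong : {P Q : Set} (P? : Dec P) (Q? : Dec Q) → (P → Q) → (Q → P) →
                   indicator P? ≡ indicator Q?
  indicator-cong (yes _) (yes _) _   _   = refl
  indicator-cong (no _)  (no _)  _   _   = refl
  indicator-cong (yes p) (no ¬q) p→q _   = contradiction (p→q p) ¬q
  indicator-cong (no ¬p) (yes q) _   q→p = contradiction (q→p q) ¬p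

  ∑-cong : {f g : A → ℕ} → (∀ x → f x ≡ g x) → ∀ xs → ∑ xs f ≡ ∑ xs g
  ∑-cong f≗g []       = refl
  ∑-cong f≗g (x ∷ xs) = cong₂ _+_ (f≗g x) (∑-cong f≗g xs)

  ∑-++ : (f : A → ℕ) (xs ys : List A) → ∑ (xs ++ ys) f ≡ ∑ xs f + ∑ ys f
  ∑-++ f xs ys = trans (cong sum (map-++ f xs ys)) (sum-++ (map f xs) (map f ys))

  ∑-concatMap : (f : B → ℕ) (g : A → List B) (xs : List A) →
                ∑[ y ∈ concatMap g xs ] f y ≡ ∑[ x ∈ xs ] ∑ (g x) f
  ∑-concatMap f g []       = refl
  ∑-concatMap f g (x ∷ xs) = trans (∑-++ f (g x) (concatMap g xs)) (cong (∑ (g x) f +_) (∑-concatMap f g xs))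

  ∑-map : (f : B → ℕ) (g : A → B) (xs : List A) → ∑[ y ∈ map g xs ] f y ≡ ∑[ x ∈ xs ] f (g x)
  ∑-map f g []       = refl
  ∑-map f g (x ∷ xs) = cong (f (g x) +_) (∑-map f g xs)

  ∑-*ˡ : (c : ℕ) (f : A → ℕ) (xs : List A) → ∑[ x ∈ xs ] (c * f x) ≡ c * ∑ xs f
  ∑-*ˡ c f []       = sym (*-zeroʳ c)
  ∑-*ˡ c f (x ∷ xs) = trans (cong (c * f x +_) (∑-*ˡ c f xs)) (sym (*-distribˡ-+ c (f x) _))

  ∑-const : (c : ℕ) (xs : List A) → ∑[ x ∈ xs ] c ≡ length xs * c
  ∑-const c []       = refl
  ∑-const c (x ∷ xs) = cong (c +_) (∑-const c xs)

  ∑-filter : {P : A → Set} (P? : ∀ x → Dec (P x)) (f : A → ℕ) (xs : List A) →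
             ∑[ x ∈ filter P? xs ] f x ≡ ∑[ x ∈ xs ] (indicator (P? x) * f x)
  ∑-filter P? f []       = refl
  ∑-filter P? f (x ∷ xs) with P? x
  ... | yes _ = cong₂ _+_ (sym (+-identityʳ (f x))) (∑-filter P? f xs)
  ... | no _  = ∑-filter P? f xs

  length-filter : {P : A → Set} (P? : ∀ x → Dec (P x)) (xs : List A) →
                  length (filter P? xs) ≡ ∑[ x ∈ xs ] indicator (P? x)
  length-filter P? []       = refl
  length-filter P? (x ∷ xs) with P? x
  ... | yes _ = cong suc (length-filter P? xs)
  ... | no _  = length-filter P? xs

  ∑-tabulate : ∀ n (f : Fin n → A) (g : A → ℕ) → ∑[ x ∈ tabulate f ] g x ≡ sumᶠ (g ∘ f)
  ∑-tabulate zero    f g = refl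
  ∑-tabulate (suc n) f g = cong (g (f zero) +_) (∑-tabulate n (f ∘ suc) g)

  ∑-allFin-suc : (g : Fin (suc n) → ℕ) → ∑[ i ∈ allFin (suc n) ] g i ≡ g zero + ∑[ i ∈ allFin n ] g (suc i)
  ∑-allFin-suc {n} g = cong (g zero +_) (trans (∑-tabulate n suc g) (sym (∑-tabulate n id (g ∘ suc))))

  ∑-allFin-permute : (π : Permutation n n) (g : Fin n → ℕ) →
                     ∑[ i ∈ allFin n ] g (π ⟨$⟩ʳ i) ≡ ∑[ i ∈ allFin n ] g i
  ∑-allFin-permute {n} π g = begin
    ∑[ i ∈ allFin n ] g (π ⟨$⟩ʳ i) ≡⟨ ∑-tabulate n id (g ∘ (π ⟨$⟩ʳ_)) ⟩
    sumᶠ (g ∘ (π ⟨$⟩ʳ_))           ≡⟨ sum-permute g π ⟨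
    sumᶠ g                         ≡⟨ ∑-tabulate n id g ⟨
    ∑[ i ∈ allFin n ] g i          ∎

module ModularAddition where

  open import Data.Fin using (Fin; toℕ)
  open import Data.Fin.Permutation using (Permutation; permutation)
  open import Data.Fin.Properties using (toℕ-fromℕ<; toℕ-injective; toℕ<n; toℕ≤n)
  open import Data.Nat using (ℕ; _+_; _∸_; NonZero; _%_)
  open import Data.Nat.DivMod using (_mod_; %-distribˡ-+; m%n%n≡m%n; [m+n]%n≡m%n; m<n⇒m%n≡m; m%n<n)
  open import Data.Nat.Properties using (+-comm; +-assoc; m+[n∸m]≡n; m∸n+n≡m)
  open import Relation.Binary.PropositionalEquality
  open ≡-Reasoning

  module _ {m : ℕ} .{{_ : NonZero m}} where

    infixl 6 _⊕_

    _⊕_ : Fin m → Fin m → Fin m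
    a ⊕ b = (toℕ a + toℕ b) mod m

    ⊕-comm : ∀ a b → a ⊕ b ≡ b ⊕ a
    ⊕-comm a b = cong (_mod m) (+-comm (toℕ a) (toℕ b))

    private
      -- c − a in ℤ/m, computed as (m ∸ a) + c to stay within ℕ
      minus : Fin m → Fin m → Fin m
      minus a c = ((m ∸ toℕ a) + toℕ c) mod m

      toℕ-mod : ∀ x → toℕ (x mod m) ≡ x % m
      toℕ-mod x = toℕ-fromℕ< (m%n<n x m)

      [x+y%m]%m≡[x+y]%m : ∀ x y → (x + y % m) % m ≡ (x + y) % m
      [x+y%m]%m≡[x+y]%m x y = begin
        (x + y % m) % m         ≡⟨ %-distribˡ-+ x (y % m) m ⟩
        (x % m + y % m % m) % m ≡⟨ cong (λ z → (x % m + z) % m) (m%n%n≡m%n y m) ⟩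
        (x % m + y % m) % m     ≡⟨ %-distribˡ-+ x y m ⟨
        (x + y) % m             ∎

      add-complement : ∀ i j (c : Fin m) → i + j ≡ m → toℕ ((i + (j + toℕ c)) mod m) ≡ toℕ c
      add-complement i j c i+j≡m = begin
        toℕ ((i + (j + toℕ c)) mod m) ≡⟨ toℕ-mod (i + (j + toℕ c)) ⟩
        (i + (j + toℕ c)) % m         ≡⟨ cong (_% m) (+-assoc i j (toℕ c)) ⟨
        (i + j + toℕ c) % m           ≡⟨ cong (λ z → (z + toℕ c) % m) i+j≡m ⟩
        (m + toℕ c) % m               ≡⟨ cong (_% m) (+-comm m (toℕ c)) ⟩
        (toℕ c + m) % m               ≡⟨ [m+n]%n≡m%n (toℕ c) m ⟩
        toℕ c % m                     ≡⟨ m<n⇒m%n≡m (toℕ<n c) ⟩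
        toℕ c                         ∎

      ⊕-minus : ∀ a c → a ⊕ minus a c ≡ c
      ⊕-minus a c = toℕ-injective (begin
        toℕ (a ⊕ minus a c)                             ≡⟨ toℕ-mod (toℕ a + toℕ (minus a c)) ⟩
        (toℕ a + toℕ (minus a c)) % m                   ≡⟨ cong (λ z → (toℕ a + z) % m) (toℕ-mod _) ⟩
        (toℕ a + (m ∸ toℕ a + toℕ c) % m) % m           ≡⟨ [x+y%m]%m≡[x+y]%m (toℕ a) _ ⟩
        (toℕ a + (m ∸ toℕ a + toℕ c)) % m               ≡⟨ toℕ-mod _ ⟨
        toℕ ((toℕ a + (m ∸ toℕ a + toℕ c)) mod m)       ≡⟨ add-complement (toℕ a) _ c (m+[n∸m]≡n (toℕ≤n a)) ⟩
        toℕ c                                           ∎)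

      minus-⊕ : ∀ a b → minus a (a ⊕ b) ≡ b
      minus-⊕ a b = toℕ-injective (begin
        toℕ (minus a (a ⊕ b))                           ≡⟨ toℕ-mod (m ∸ toℕ a + toℕ (a ⊕ b)) ⟩
        (m ∸ toℕ a + toℕ (a ⊕ b)) % m                   ≡⟨ cong (λ z → (m ∸ toℕ a + z) % m) (toℕ-mod _) ⟩
        (m ∸ toℕ a + (toℕ a + toℕ b) % m) % m           ≡⟨ [x+y%m]%m≡[x+y]%m (m ∸ toℕ a) _ ⟩
        (m ∸ toℕ a + (toℕ a + toℕ b)) % m               ≡⟨ toℕ-mod _ ⟨
        toℕ ((m ∸ toℕ a + (toℕ a + toℕ b)) mod m)       ≡⟨ add-complement _ (toℕ a) b (m∸n+n≡m (toℕ≤n a)) ⟩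
        toℕ b                                           ∎)

    translateˡ : Fin m → Permutation m m
    translateˡ a = permutation (a ⊕_) (minus a) (⊕-minus a) (minus-⊕ a)

    translateʳ : Fin m → Permutation m m
    translateʳ a = permutation (_⊕ a) (minus a)
      (λ c → trans (⊕-comm (minus a c) a) (⊕-minus a c))
      (λ b → trans (cong (minus a) (⊕-comm b a)) (minus-⊕ a b))

module BlockCollapse where

  open ListSums
  open ModularAddition

  open import Data.Fin using (Fin; zero; _≟_)
  open import Data.Fin.Permutation using (Permutation; _⟨$⟩ʳ_)
  import Data.Integer as ℤ
  import Data.Integer.Properties as ℤₚ
  open import Data.List using (List; map; filter; length; allFin)
  open import Data.List.Properties using (length-tabulate)
  open import Data.Nat
    using (ℕ; zero; suc; _+_; _*_; _∸_; _^_; _≤_; _<_; _⊓_; _%_; z≤n; s≤s; s≤s⁻¹; NonZero; ∣_-_∣)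
  open import Data.Nat.DivMod using (m≡m%n+[m/n]*n; m%n<n; m≥n⇒m/n>0; m<n*o⇒m/o<n)
  open import Data.Nat.Properties hiding (_≟_)
  open import Data.Product using (Σ; Σ-syntax; _×_; _,_)
  open import Data.Vec using (Vec; []; _∷_; lookup; replicate; _[_]≔_; _[_]%=_)
    renaming (sum to sumᵥ; map to mapᵥ)
  open import Data.Vec.Properties using ([]≔-lookup)
  open import Data.Vec.Relation.Unary.All as All using (All; []; _∷_)
  open import Data.Vec.Relation.Unary.All.Properties using (map⁺)
  open import Function using (_∘_; id)
  open import Function.Bundles using (Injection)
  open import Function.Properties.Inverse using (↔⇒↣)
  open import Relation.Nullary using (¬?)
  open import Relation.Binary.PropositionalEquality

  private
    variable
      k m n : ℕ

  -- the degree of a in K_m coloured by g; a line of H(k,m) (one coordinate varying) is such a K_m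
  lineDegree : (Fin m → Fin m) → Fin m → ℕ
  lineDegree {m} g a = ∑[ b ∈ allFin m ] (indicator (¬? (b ≟ a)) * indicator (g b ≟ g a))

  lineDegree-permute : (π : Permutation m m) (g : Fin m → Fin m) (a : Fin m) →
                       lineDegree (g ∘ (π ⟨$⟩ʳ_)) a ≡ lineDegree g (π ⟨$⟩ʳ a)
  lineDegree-permute {m} π g a = begin
    ∑[ b ∈ allFin m ] (indicator (¬? (b ≟ a)) * F (π ⟨$⟩ʳ b))
      ≡⟨ ∑-cong (λ b → cong (_* F (π ⟨$⟩ʳ b)) (distinct b)) (allFin m) ⟩
    ∑[ b ∈ allFin m ] (indicator (¬? (π ⟨$⟩ʳ b ≟ π ⟨$⟩ʳ a)) * F (π ⟨$⟩ʳ b))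
      ≡⟨ ∑-allFin-permute π (λ b → indicator (¬? (b ≟ π ⟨$⟩ʳ a)) * F b) ⟩
    lineDegree g (π ⟨$⟩ʳ a) ∎
    where
    open ≡-Reasoning
    F : Fin m → ℕ
    F b = indicator (g b ≟ g (π ⟨$⟩ʳ a))
    distinct : ∀ b → indicator (¬? (b ≟ a)) ≡ indicator (¬? (π ⟨$⟩ʳ b ≟ π ⟨$⟩ʳ a))
    distinct b = indicator-cong (¬? (b ≟ a)) (¬? (π ⟨$⟩ʳ b ≟ π ⟨$⟩ʳ a))
      (λ b≢a → b≢a ∘ Injection.injective (↔⇒↣ π))
      (λ πb≢πa → πb≢πa ∘ cong (π ⟨$⟩ʳ_))

  weightedDegree : Vec ℕ k → Partition k m → Vec (Fin m) k → ℕ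
  weightedDegree []       c []      = 0
  weightedDegree (w ∷ ws) c (a ∷ u) =
    w * lineDegree (λ b → c (b ∷ u)) a + weightedDegree ws (λ v → c (a ∷ v)) u

  inducedDegree-coordinates : (c : Partition k m) (v : Vec (Fin m) k) →
    inducedDegree c v ≡ ∑[ j ∈ allFin k ] lineDegree (λ b → c (v [ j ]≔ b)) (lookup v j)
  inducedDegree-coordinates {k} {m} c v = begin
    inducedDegree c v                                                  ≡⟨ length-filter _ (neighbours v) ⟩
    ∑[ w ∈ neighbours v ] indicator (c w ≟ c v)                        ≡⟨ ∑-concatMap _ neighboursAlong (allFin k) ⟩
    ∑[ j ∈ allFin k ] ∑[ w ∈ neighboursAlong j ] indicator (c w ≟ c v) ≡⟨ ∑-cong along (allFin k) ⟩
    ∑[ j ∈ allFin k ] lineDegree (λ b → c (v [ j ]≔ b)) (lookup v j)   ∎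
    where
    open ≡-Reasoning
    otherValues : Fin k → List (Fin m)
    otherValues j = filter (λ a → ¬? (a ≟ lookup v j)) (allFin m)
    neighboursAlong : Fin k → List (Vec (Fin m) k)
    neighboursAlong j = map (v [ j ]≔_) (otherValues j)
    along : ∀ j → ∑[ w ∈ neighboursAlong j ] indicator (c w ≟ c v)
                  ≡ lineDegree (λ b → c (v [ j ]≔ b)) (lookup v j)
    along j = begin
      ∑[ w ∈ neighboursAlong j ] indicator (c w ≟ c v)
        ≡⟨ ∑-map (λ w → indicator (c w ≟ c v)) (v [ j ]≔_) (otherValues j) ⟩
      ∑[ b ∈ otherValues j ] indicator (c (v [ j ]≔ b) ≟ c v)
        ≡⟨ ∑-filter (λ a → ¬? (a ≟ lookup v j)) (λ b → indicator (c (v [ j ]≔ b) ≟ c v)) (allFin m) ⟩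
      ∑[ b ∈ allFin m ] (indicator (¬? (b ≟ lookup v j)) * indicator (c (v [ j ]≔ b) ≟ c v))
        ≡⟨ ∑-cong (λ b → cong (λ u → indicator (¬? (b ≟ lookup v j)) * indicator (c (v [ j ]≔ b) ≟ c u))
                              (sym ([]≔-lookup v j)))
                  (allFin m) ⟩
      lineDegree (λ b → c (v [ j ]≔ b)) (lookup v j) ∎

  ∑-lineDegree≡weightedDegree : (c : Partition k m) (v : Vec (Fin m) k) →
    ∑[ j ∈ allFin k ] lineDegree (λ b → c (v [ j ]≔ b)) (lookup v j) ≡ weightedDegree (replicate k 1) c v
  ∑-lineDegree≡weightedDegree c []      = refl
  ∑-lineDegree≡weightedDegree c (a ∷ u) =
    trans (∑-allFin-suc (λ j → lineDegree (λ b → c ((a ∷ u) [ j ]≔ b)) (lookup (a ∷ u) j)))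
    (cong₂ _+_ (sym (*-identityˡ _)) (∑-lineDegree≡weightedDegree (λ w → c (a ∷ w)) u))

  inducedDegree≡weightedDegree : (c : Partition k m) (v : Vec (Fin m) k) →
                                 inducedDegree c v ≡ weightedDegree (replicate k 1) c v
  inducedDegree≡weightedDegree c v =
    trans (inducedDegree-coordinates c v) (∑-lineDegree≡weightedDegree c v)

  weightedDegree-≤ : {q : ℕ} {ws : Vec ℕ k} → All (_≤ q) ws → (c : Partition k m) (v : Vec (Fin m) k) →
                     weightedDegree ws c v ≤ q * weightedDegree (replicate k 1) c v
  weightedDegree-≤ []                               c []      = z≤n
  weightedDegree-≤ {q = q} {w ∷ ws} (w≤q ∷ ws≤q) c (a ∷ u) = begin
    w * L + weightedDegree ws c′ u ≤⟨ +-mono-≤ (*-monoˡ-≤ L w≤q) (weightedDegree-≤ ws≤q c′ u) ⟩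
    q * L + q * W                  ≡⟨ *-distribˡ-+ q L W ⟨
    q * (L + W)                    ≡⟨ cong (λ x → q * (x + W)) (*-identityˡ L) ⟨
    q * (1 * L + W)                ∎
    where
    open ≤-Reasoning
    L = lineDegree (λ b → c (b ∷ u)) a
    c′ = λ v → c (a ∷ v)
    W = weightedDegree (replicate _ 1) c′ u

  module _ .{{_ : NonZero m}} where

    -- A vertex is cut into consecutive blocks of 1 + t₀, 1 + t₁, … coordinates,
    -- and each block is replaced by its sum in ℤ/m.
    collapse : (ts : Vec ℕ k) → Vec (Fin m) (sumᵥ (mapᵥ suc ts)) → Vec (Fin m) k
    collapse []           []      = []
    collapse (zero ∷ ts)  (a ∷ v) = a ∷ collapse ts v
    collapse (suc t ∷ ts) (a ∷ v) = collapse (t ∷ ts) v [ zero ]%= (a ⊕_)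

    weightedDegree-mergeHead : (c : Partition (suc k) m) (a : Fin m) (x : ℕ) (ws : Vec ℕ k)
      (s : Vec (Fin m) (suc k)) →
      lineDegree (λ b → c (s [ zero ]%= (b ⊕_))) a + weightedDegree (x ∷ ws) (λ y → c (y [ zero ]%= (a ⊕_))) s
        ≡ weightedDegree (suc x ∷ ws) c (s [ zero ]%= (a ⊕_))
    weightedDegree-mergeHead c a x ws (y ∷ u) = begin
      lineDegree (g ∘ (translateʳ y ⟨$⟩ʳ_)) a + (x * lineDegree (g ∘ (translateˡ a ⟨$⟩ʳ_)) y + W)
        ≡⟨ cong₂ (λ l l′ → l + (x * l′ + W))
                 (lineDegree-permute (translateʳ y) g a) (lineDegree-permute (translateˡ a) g y) ⟩
      L + (x * L + W) ≡⟨ +-assoc L (x * L) W ⟨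
      suc x * L + W   ∎
      where
      open ≡-Reasoning
      g : Fin m → Fin m
      g b = c (b ∷ u)
      L = lineDegree g (a ⊕ y)
      W = weightedDegree ws (λ t → c ((a ⊕ y) ∷ t)) u

    weightedDegree-collapse : (ts : Vec ℕ k) (c : Partition k m) (v : Vec (Fin m) (sumᵥ (mapᵥ suc ts))) →
      weightedDegree (replicate _ 1) (c ∘ collapse ts) v ≡ weightedDegree (mapᵥ suc ts) c (collapse ts v)
    weightedDegree-collapse []           c []      = refl
    weightedDegree-collapse (zero ∷ ts)  c (a ∷ v) =
      cong (1 * lineDegree (λ b → c (b ∷ collapse ts v)) a +_) (weightedDegree-collapse ts (λ y → c (a ∷ y)) v)
    weightedDegree-collapse (suc t ∷ ts) c (a ∷ v) = trans
      (cong₂ _+_ (*-identityˡ _) (weightedDegree-collapse (t ∷ ts) (λ y → c (y [ zero ]%= (a ⊕_))) v))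
      (weightedDegree-mergeHead c a (suc t) (mapᵥ suc ts) (collapse (t ∷ ts) v))

    collapse-maxDegree : {p d′ : ℕ} (ts : Vec ℕ k) → All (_≤ p) ts → (c : Partition k m) →
                         MaxDegreeAtMost c d′ → MaxDegreeAtMost (c ∘ collapse ts) (suc p * d′)
    collapse-maxDegree {p = p} {d′} ts ts≤p c Δ≤d′ v = begin
      inducedDegree (c ∘ collapse ts) v                  ≡⟨ inducedDegree≡weightedDegree (c ∘ collapse ts) v ⟩
      weightedDegree (replicate _ 1) (c ∘ collapse ts) v ≡⟨ weightedDegree-collapse ts c v ⟩
      weightedDegree (mapᵥ suc ts) c y                   ≤⟨ weightedDegree-≤ (map⁺ (All.map s≤s ts≤p)) c y ⟩
      suc p * weightedDegree (replicate _ 1) c y         ≡⟨ cong (suc p *_) (inducedDegree≡weightedDegree c y) ⟨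
      suc p * inducedDegree c y                          ≤⟨ *-monoʳ-≤ (suc p) (Δ≤d′ y) ⟩
      suc p * d′                                         ∎
      where
      open ≤-Reasoning
      y = collapse ts v

    ∑-vertices-suc : (f : Vec (Fin m) (suc k) → ℕ) →
      ∑[ v ∈ vertices (suc k) m ] f v ≡ ∑[ a ∈ allFin m ] ∑[ v ∈ vertices k m ] f (a ∷ v)
    ∑-vertices-suc {k} f = trans (∑-concatMap f (λ a → map (a ∷_) (vertices k m)) (allFin m))
                                 (∑-cong (λ a → ∑-map f (a ∷_) (vertices k m)) (allFin m))

    ∑-vertices-permuteHead : (π : Permutation m m) (f : Vec (Fin m) (suc k) → ℕ) →
      ∑[ v ∈ vertices (suc k) m ] f (v [ zero ]%= (π ⟨$⟩ʳ_)) ≡ ∑[ v ∈ vertices (suc k) m ] f v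
    ∑-vertices-permuteHead {k} π f = begin
      ∑[ v ∈ vertices (suc k) m ] f (v [ zero ]%= (π ⟨$⟩ʳ_))   ≡⟨ ∑-vertices-suc (λ v → f (v [ zero ]%= (π ⟨$⟩ʳ_))) ⟩
      ∑[ a ∈ allFin m ] ∑[ v ∈ vertices k m ] f ((π ⟨$⟩ʳ a) ∷ v) ≡⟨ ∑-allFin-permute π (λ a → ∑[ v ∈ vertices k m ] f (a ∷ v)) ⟩
      ∑[ a ∈ allFin m ] ∑[ v ∈ vertices k m ] f (a ∷ v)        ≡⟨ ∑-vertices-suc f ⟨
      ∑[ v ∈ vertices (suc k) m ] f v                          ∎
      where open ≡-Reasoning

    ∑-collapse : (ts : Vec ℕ k) (f : Vec (Fin m) k → ℕ) →
      ∑[ v ∈ vertices (sumᵥ (mapᵥ suc ts)) m ] f (collapse ts v) ≡ m ^ sumᵥ ts * ∑[ y ∈ vertices k m ] f y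
    ∑-collapse-∷ : (t : ℕ) (ts : Vec ℕ k) (f : Vec (Fin m) (suc k) → ℕ) →
      ∑[ v ∈ vertices (sumᵥ (mapᵥ suc (t ∷ ts))) m ] f (collapse (t ∷ ts) v)
        ≡ m ^ sumᵥ (t ∷ ts) * ∑[ y ∈ vertices (suc k) m ] f y

    ∑-collapse []       f = sym (*-identityˡ _)
    ∑-collapse (t ∷ ts) f = ∑-collapse-∷ t ts f

    ∑-collapse-∷ {k} zero ts f = begin
      ∑[ v ∈ vertices (suc len) m ] f (collapse (zero ∷ ts) v)            ≡⟨ ∑-vertices-suc (f ∘ collapse (zero ∷ ts)) ⟩
      ∑[ a ∈ allFin m ] ∑[ v ∈ vertices len m ] f (a ∷ collapse ts v)     ≡⟨ ∑-cong (λ a → ∑-collapse ts (f ∘ (a ∷_))) (allFin m) ⟩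
      ∑[ a ∈ allFin m ] (M * ∑[ y ∈ vertices k m ] f (a ∷ y))           ≡⟨ ∑-*ˡ M _ (allFin m) ⟩
      M * ∑[ a ∈ allFin m ] ∑[ y ∈ vertices k m ] f (a ∷ y)             ≡⟨ cong (M *_) (∑-vertices-suc f) ⟨
      M * ∑[ y ∈ vertices (suc k) m ] f y                               ∎
      where
      open ≡-Reasoning
      len = sumᵥ (mapᵥ suc ts)
      M = m ^ sumᵥ ts
    ∑-collapse-∷ {k} (suc t) ts f = begin
      ∑[ v ∈ vertices (suc len) m ] f (collapse (suc t ∷ ts) v)                     ≡⟨ ∑-vertices-suc (f ∘ collapse (suc t ∷ ts)) ⟩
      ∑[ a ∈ allFin m ] ∑[ v ∈ vertices len m ] f (collapse (t ∷ ts) v [ zero ]%= (a ⊕_)) ≡⟨ ∑-cong translated (allFin m) ⟩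
      ∑[ a ∈ allFin m ] (M * S)                                                   ≡⟨ ∑-const (M * S) (allFin m) ⟩
      length (allFin m) * (M * S)                                                 ≡⟨ cong (_* (M * S)) (length-tabulate {n = m} id) ⟩
      m * (M * S)                                                                 ≡⟨ *-assoc m M S ⟨
      m ^ sumᵥ (suc t ∷ ts) * S                                                   ∎
      where
      open ≡-Reasoning
      len = sumᵥ (mapᵥ suc (t ∷ ts))
      M = m ^ sumᵥ (t ∷ ts)
      S = ∑[ y ∈ vertices (suc k) m ] f y
      translated : ∀ a → ∑[ v ∈ vertices len m ] f (collapse (t ∷ ts) v [ zero ]%= (a ⊕_)) ≡ M * S
      translated a = trans (∑-collapse-∷ t ts (λ y → f (y [ zero ]%= (a ⊕_))))
                           (cong (M *_) (∑-vertices-permuteHead (translateˡ a) f))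

    classSize-collapse : (ts : Vec ℕ k) (c : Partition k m) (i : Fin m) →
                         classSize (c ∘ collapse ts) i ≡ m ^ sumᵥ ts * classSize c i
    classSize-collapse {k} ts c i = begin
      classSize (c ∘ collapse ts) i                                          ≡⟨ length-filter (λ v → c (collapse ts v) ≟ i) (vertices _ m) ⟩
      ∑[ v ∈ vertices (sumᵥ (mapᵥ suc ts)) m ] indicator (c (collapse ts v) ≟ i) ≡⟨ ∑-collapse ts (λ y → indicator (c y ≟ i)) ⟩
      m ^ sumᵥ ts * ∑[ y ∈ vertices k m ] indicator (c y ≟ i)                 ≡⟨ cong (m ^ sumᵥ ts *_) (length-filter (λ y → c y ≟ i) (vertices k m)) ⟨
      m ^ sumᵥ ts * classSize c i                                            ∎
      where open ≡-Reasoning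

  imbalance-scale : (e : ℕ) (c′ : Partition n m) (c : Partition k m) → n ≡ e + k → 1 ≤ k →
                    (∀ i → classSize c′ i ≡ m ^ e * classSize c i) → imbalance c′ ≡ m ^ e * imbalance c
  imbalance-scale {m = m} {k} e c′ c refl 1≤k scaled = begin
    ∑[ i ∈ allFin m ] ∣ classSize c′ i - m ^ (e + k ∸ 1) ∣         ≡⟨ ∑-cong term (allFin m) ⟩
    ∑[ i ∈ allFin m ] (m ^ e * ∣ classSize c i - m ^ (k ∸ 1) ∣)     ≡⟨ ∑-*ˡ (m ^ e) _ (allFin m) ⟩
    m ^ e * imbalance c                                            ∎
    where
    open ≡-Reasoning
    average : m ^ (e + k ∸ 1) ≡ m ^ e * m ^ (k ∸ 1)
    average = trans (cong (m ^_) (+-∸-assoc e 1≤k)) (^-distribˡ-+-* m e (k ∸ 1))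
    term : ∀ i → ∣ classSize c′ i - m ^ (e + k ∸ 1) ∣ ≡ m ^ e * ∣ classSize c i - m ^ (k ∸ 1) ∣
    term i = trans (cong₂ ∣_-_∣ (scaled i) average)
                   (sym (*-distribˡ-∣-∣ (m ^ e) (classSize c i) (m ^ (k ∸ 1))))

  sum-map-suc : (ts : Vec ℕ k) → sumᵥ (mapᵥ suc ts) ≡ sumᵥ ts + k
  sum-map-suc []               = refl
  sum-map-suc {suc k} (t ∷ ts) = begin
    suc (t + sumᵥ (mapᵥ suc ts)) ≡⟨ cong (λ x → suc (t + x)) (sum-map-suc ts) ⟩
    suc (t + (sumᵥ ts + k))      ≡⟨ cong suc (+-assoc t (sumᵥ ts) k) ⟨
    suc (t + sumᵥ ts + k)        ≡⟨ +-suc (t + sumᵥ ts) k ⟨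
    t + sumᵥ ts + suc k          ∎
    where open ≡-Reasoning

  imbalance-collapse : .{{_ : NonZero m}} (ts : Vec ℕ k) → 1 ≤ k → (c : Partition k m) →
                       imbalance (c ∘ collapse ts) ≡ m ^ sumᵥ ts * imbalance c
  imbalance-collapse ts 1≤k c =
    imbalance-scale (sumᵥ ts) (c ∘ collapse ts) c (sum-map-suc ts) 1≤k (classSize-collapse ts c)

  bounded-parts : ∀ p k e → e ≤ p * k → Σ[ ts ∈ Vec ℕ k ] All (_≤ p) ts × sumᵥ ts ≡ e
  bounded-parts p zero    e e≤p*0 = [] , [] , sym (n≤0⇒n≡0 (≤-trans e≤p*0 (≤-reflexive (*-zeroʳ p))))
  bounded-parts p (suc k) e e≤p*k+p with bounded-parts p k (e ∸ p)
    (m≤n+o⇒m∸n≤o e p (≤-trans e≤p*k+p (≤-reflexive (*-suc p k))))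
  ... | ts , ts≤p , ∑ts≡e∸p =
    p ⊓ e ∷ ts , m⊓n≤m p e ∷ ts≤p , trans (cong (p ⊓ e +_) ∑ts≡e∸p) (m⊓n+n∸m≡n p e)

  ceilDiv-pos : ∀ n p → 1 ≤ n → 1 ≤ ceilDiv n (suc p)
  ceilDiv-pos n p 1≤n = m≥n⇒m/n>0 {n + p} {suc p} (+-monoˡ-≤ p 1≤n)

  ceilDiv-≤ : ∀ n p → ceilDiv n (suc p) ≤ n
  ceilDiv-≤ n p = s≤s⁻¹ (m<n*o⇒m/o<n {n + p} {suc n} {suc p} n+p<[1+n]*[1+p])
    where
    n+p<[1+n]*[1+p] : n + p < suc n * suc p
    n+p<[1+n]*[1+p] = s≤s (≤-trans (≤-reflexive (+-comm n p)) (+-monoʳ-≤ p (m≤m*n n (suc p))))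

  ≤-ceilDiv-* : ∀ n p → n ≤ ceilDiv n (suc p) * suc p
  ≤-ceilDiv-* n p = +-cancelˡ-≤ p n (n′ * suc p) (begin
    p + n                          ≡⟨ +-comm p n ⟩
    n + p                          ≡⟨ m≡m%n+[m/n]*n (n + p) (suc p) ⟩
    (n + p) % suc p + n′ * suc p   ≤⟨ +-monoˡ-≤ (n′ * suc p) (s≤s⁻¹ (m%n<n (n + p) (suc p))) ⟩
    p + n′ * suc p                 ∎)
    where
    open ≤-Reasoning
    n′ = ceilDiv n (suc p)

  ∸-ceilDiv-≤ : ∀ n p → n ∸ ceilDiv n (suc p) ≤ p * ceilDiv n (suc p)
  ∸-ceilDiv-≤ n p = begin
    n ∸ n′               ≤⟨ ∸-monoˡ-≤ n′ (≤-ceilDiv-* n p) ⟩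
    n′ * suc p ∸ n′      ≡⟨ cong (_∸ n′) (*-suc n′ p) ⟩
    n′ + n′ * p ∸ n′     ≡⟨ m+n∸m≡n n′ (n′ * p) ⟩
    n′ * p               ≡⟨ *-comm n′ p ⟩
    p * n′               ∎
    where
    open ≤-Reasoning
    n′ = ceilDiv n (suc p)

  *-monoˡ-≤-pos : (c x : ℕ) {i : ℤ.ℤ} → i ℤ.≤ ℤ.+ x → ℤ.+ c ℤ.* i ℤ.≤ ℤ.+ (c * x)
  *-monoˡ-≤-pos c x i≤x =
    ℤₚ.≤-trans (ℤₚ.*-monoˡ-≤-nonNeg (ℤ.+ c) i≤x) (ℤₚ.≤-reflexive (sym (ℤₚ.pos-* c x)))

  collapsedPartition : .{{_ : NonZero m}} {p d d′ e : ℕ} {i′ : ℤ.ℤ} (ts : Vec ℕ k) → All (_≤ p) ts →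
    1 ≤ k → suc p * d′ ≤ d → sumᵥ (mapᵥ suc ts) ≡ n → sumᵥ ts ≡ e →
    (Π′ : Partition k m) → MaxDegreeAtMost Π′ d′ → i′ ℤ.≤ ℤ.+ imbalance Π′ →
    Σ (Partition n m) (λ Π → MaxDegreeAtMost Π d × ℤ.+ (m ^ e) ℤ.* i′ ℤ.≤ ℤ.+ imbalance Π)
  collapsedPartition {m = m} ts ts≤p 1≤k [1+p]d′≤d refl refl Π′ Δ≤d′ i′≤ι =
    Π′ ∘ collapse ts ,
    (λ v → ≤-trans (collapse-maxDegree ts ts≤p Π′ Δ≤d′ v) [1+p]d′≤d) ,
    subst (λ x → ℤ.+ (m ^ sumᵥ ts) ℤ.* _ ℤ.≤ ℤ.+ x) (sym (imbalance-collapse ts 1≤k Π′))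
          (*-monoˡ-≤-pos (m ^ sumᵥ ts) (imbalance Π′) i′≤ι)

  blowUp : .{{_ : NonZero m}} {d d′ : ℕ} {i′ : ℤ.ℤ} (q : ℕ) → 1 ≤ q → q * d′ ≤ d → 1 ≤ n →
    Σ (Partition (ceilDiv n q) m) (λ Π′ → MaxDegreeAtMost Π′ d′ × i′ ℤ.≤ ℤ.+ imbalance Π′) →
    Σ (Partition n m) (λ Π → MaxDegreeAtMost Π d × ℤ.+ (m ^ (n ∸ ceilDiv n q)) ℤ.* i′ ℤ.≤ ℤ.+ imbalance Π)
  blowUp {n = n} (suc p) _ qd′≤d 1≤n (Π′ , Δ≤d′ , i′≤ι)
    with bounded-parts p (ceilDiv n (suc p)) (n ∸ ceilDiv n (suc p)) (∸-ceilDiv-≤ n p)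
  ... | ts , ts≤p , ∑ts≡n∸n′ =
    collapsedPartition ts ts≤p (ceilDiv-pos n p 1≤n) qd′≤d length≡n ∑ts≡n∸n′ Π′ Δ≤d′ i′≤ι
    where
    length≡n : sumᵥ (mapᵥ suc ts) ≡ n
    length≡n = trans (sum-map-suc ts) (trans (cong (_+ ceilDiv n (suc p)) ∑ts≡n∸n′) (m∸n+n≡m (ceilDiv-≤ n p)))

open BlockCollapse using (blowUp)

open import Data.Nat using (ℕ; _≤_; _^_; _∸_; s≤s)
open import Data.Integer using (ℤ; +_; _*_) renaming (_≤_ to _≤ℤ_)
open import Data.Product using (Σ; _×_)
open import Data.Nat.Properties using (≤-trans)
open import Data.Nat.DivMod using (m≥n⇒m/n>0; m/n*n≤m)

lemma2p3 : (m n d d' : ℕ) (i' : ℤ) →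
    2 ≤ m → d ≤ n → 1 ≤ d → 1 ≤ d' → d' ≤ d →
    Σ (Partition (nPrime n d d') m)
      (λ Π' → MaxDegreeAtMost Π' d' × i' ≤ℤ + imbalance Π') →
    Σ (Partition n m)
      (λ Π → MaxDegreeAtMost Π d ×
             (+ (m ^ (n ∸ nPrime n d d'))) * i' ≤ℤ + imbalance Π)
lemma2p3 m n d d' i' (s≤s (s≤s _)) d≤n 1≤d (s≤s _) d'≤d =
  blowUp (floorDiv d d') (m≥n⇒m/n>0 d'≤d) (m/n*n≤m d d') (≤-trans 1≤d d≤n)
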